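{- Let $p$ be a propositional atom. Let $(T^-_{KP})_0$ be the smallest closed theory containing $\mathbf{V}$, $\mathbf{K}$, and the formula $p\leftrightarrow\mathrm{K}\neg p$, and let $T^-_{KP}=(T^-_{KP})_0\cup\mathbf{T}$. Then $T^-_{KP}$ is consistent.
   Context: Fix a nonempty set of symbols called propositional atoms and a symbol $\mathrm{K}$ which is not a propositional atom. Formulas are defined recursively: every propositional atom is a formula; if $\varphi,\psi$ are formulas then so are $\neg\varphi$, $(\varphi\wedge\psi)$, $(\varphi\vee\psi)$, $(\varphi\rightarrow\psi)$; if $\varphi$ is a formula then so is $\mathrm{K}(\varphi)$. $\varphi\leftrightarrow\psi$ abbreviates $(\varphi\rightarrow\psi)\wedge(\psi\rightarrow\varphi)$. A formula is basic if it is a propositional atom or of the form $\mathrm{K}\varphi$. A theory is a set of formulas. A model is a function assigning a truth value to every basic formula; truth $\mathscr M\models\varphi$ of an arbitrary formula is defined from the values of basic formulas by the classical truth tables (formulas $\mathrm{K}\varphi$ are treated like atoms). $\mathscr M\models T$ means $\mathscr M\models\varphi$ for all $\varphi\in T$; $T\models\varphi$ means every model of $T$ satisfies $\varphi$; $\varphi$ is valid if $\emptyset\models\varphi$; $T$ is consistent if some model satisfies $T$. A theory $T$ is closed if $\varphi\in T$ implies $\mathrm{K}\varphi\in T$. $\mathbf{V}=\{\mathrm{K}\varphi:\varphi\text{ valid}\}$; $\mathbf{K}=\{\mathrm{K}(\varphi\rightarrow\psi)\rightarrow(\mathrm{K}\varphi\rightarrow\mathrm{K}\psi)\}$; $\mathbf{T}=\{\mathrm{K}\varphi\rightarrow\varphi\}$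 (all formulas of these forms). -}

module Defs where

open import Data.Bool using (Bool; true; false; not; _∧_; _∨_)
open import Data.Product using (Σ; _×_)
open import Data.Sum using (_⊎_)
open import Relation.Binary.PropositionalEquality using (_≡_)

module _ (Atom : Set) where

  data Formula : Set where
    atom : Atom → Formula
    ¬'_  : Formula → Formula
    _∧'_ : Formula → Formula → Formula
    _∨'_ : Formula → Formula → Formula
    _⇒'_ : Formula → Formula → Formula
    K    : Formula → Formula

  infixr 6 _∧'_
  infixr 5 _∨'_
  infixr 4 _⇒'_

  _⇔'_ : Formula → Formula → Formula
  φ ⇔' ψ = (φ ⇒' ψ) ∧' (ψ ⇒' φ)

  -- A model assigns a truth value to every basic formula: to every atom
  -- and to every formula of the form K φ (the latter indexed by φ).
  record Model : Set where
    field
      valAtom : Atom → Bool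
      valK    : Formula → Bool
  open Model public

  _⇒ᵇ_ : Bool → Bool → Bool
  a ⇒ᵇ b = not a ∨ b

  eval : Model → Formula → Bool
  eval M (atom a) = valAtom M a
  eval M (¬' φ) = not (eval M φ)
  eval M (φ ∧' ψ) = eval M φ ∧ eval M ψ
  eval M (φ ∨' ψ) = eval M φ ∨ eval M ψ
  eval M (φ ⇒' ψ) = eval M φ ⇒ᵇ eval M ψ
  eval M (K φ) = valK M φ

  _⊨_ : Model → Formula → Set
  M ⊨ φ = eval M φ ≡ true

  Theory : Set₁
  Theory = Formula → Set

  _⊨T_ : Model → Theory → Set
  M ⊨T T = ∀ φ → T φ → M ⊨ φ

  Valid : Formula → Set
  Valid φ = ∀ M → M ⊨ φ

  Consistent : Theory → Set
  Consistent T = Σ Model (λ M → M ⊨T T)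

  Closed : Theory → Set
  Closed T = ∀ φ → T φ → T (K φ)

  TAx : Theory
  TAx χ = Σ Formula (λ φ → χ ≡ (K φ ⇒' φ))

  -- (T⁻_KP)₀ : the smallest closed theory containing V, K and p ↔ K¬p
  -- (inductively generated, hence least).
  data TKP0 (p : Atom) : Theory where
    fromV   : ∀ φ → Valid φ → TKP0 p (K φ)
    fromK   : ∀ φ ψ → TKP0 p (K (φ ⇒' ψ) ⇒' (K φ ⇒' K ψ))
    fromAx  : TKP0 p (atom p ⇔' K (¬' atom p))
    closure : ∀ φ → TKP0 p φ → TKP0 p (K φ)

  TKP : Atom → Theory
  TKP p χ = TKP0 p χ ⊎ TAx χ

{-# OPTIONS --safe #-}
-- The model is the actual world w of a two-world Kripke frame: w sees itself
-- and a "non-normal" world where every basic formula, hence every axiom of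
-- (T⁻_KP)₀, is true.  Setting p false at w and reading K φ at w as "φ holds at
-- w and at the other world" validates V, K and T at w, and K ¬p is false at w
-- because ¬p fails at the other world, so p ↔ K ¬p holds.  Closure is
-- preserved because every member of (T⁻_KP)₀ holds at both worlds.
module Submission where

open import Defs
open import Data.Bool using (Bool; true; false; not; _∧_; _∨_)
open import Data.Product using (_,_)
open import Data.Sum using (inj₁; inj₂)
open import Relation.Binary.PropositionalEquality using (_≡_; refl; sym; trans; cong; cong₂)

private
  variable
    a b : Bool

∧-intro : a ≡ true → b ≡ true → a ∧ b ≡ true
∧-intro refl refl = refl

∧-elimˡ : a ∧ b ≡ true → a ≡ true
∧-elimˡ {true} _ = refl

∧-elimʳ : a ∧ b ≡ true → b ≡ true
∧-elimʳ {true} h = h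

module _ {Atom : Set} where

  private
    variable
      M : Model Atom

  ⊨-⇒-intro : ∀ φ ψ → (_⊨_ Atom M φ → _⊨_ Atom M ψ) → _⊨_ Atom M (φ ⇒' ψ)
  ⊨-⇒-intro {M} φ ψ f with eval Atom M φ
  ... | true  = f refl
  ... | false = refl

  ⊨-⇒-elim : ∀ φ ψ → _⊨_ Atom M (φ ⇒' ψ) → _⊨_ Atom M φ → _⊨_ Atom M ψ
  ⊨-⇒-elim φ ψ h Mφ rewrite Mφ = h

  allTrue : Model Atom
  allTrue = record { valAtom = λ _ → true ; valK = λ _ → true }

  allTrue-⊨-TKP0 : ∀ {p φ} → TKP0 Atom p φ → _⊨_ Atom allTrue φ
  allTrue-⊨-TKP0 (fromV _ _)   = refl
  allTrue-⊨-TKP0 (fromK _ _)   = refl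
  allTrue-⊨-TKP0 fromAx        = refl
  allTrue-⊨-TKP0 (closure _ _) = refl

  -- The actual world (atoms valued by v) of a frame in which it sees itself
  -- and one other world, whose basic formulas are valued by N.
  module TwoWorldFrame (N : Model Atom) (v : Atom → Bool) where

    value : Formula Atom → Bool
    value (atom x) = v x
    value (¬' φ)   = not (value φ)
    value (φ ∧' ψ) = value φ ∧ value ψ
    value (φ ∨' ψ) = value φ ∨ value ψ
    value (φ ⇒' ψ) = _⇒ᵇ_ Atom (value φ) (value ψ)
    value (K φ)    = value φ ∧ eval Atom N φ

    model : Model Atom
    model = record { valAtom = v ; valK = λ φ → value (K φ) }

    eval-model : ∀ φ → eval Atom model φ ≡ value φ
    eval-model (atom x) = refl
    eval-model (¬' φ)   = cong not (eval-model φ)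
    eval-model (φ ∧' ψ) = cong₂ _∧_ (eval-model φ) (eval-model ψ)
    eval-model (φ ∨' ψ) = cong₂ _∨_ (eval-model φ) (eval-model ψ)
    eval-model (φ ⇒' ψ) = cong₂ (_⇒ᵇ_ Atom) (eval-model φ) (eval-model ψ)
    eval-model (K φ)    = refl

    eval-K : ∀ φ → eval Atom model (K φ) ≡ eval Atom model φ ∧ eval Atom N φ
    eval-K φ = cong (_∧ eval Atom N φ) (sym (eval-model φ))

    K-intro : ∀ φ → _⊨_ Atom model φ → _⊨_ Atom N φ → _⊨_ Atom model (K φ)
    K-intro φ hφ Nφ = trans (eval-K φ) (∧-intro hφ Nφ)

    K-elimˡ : ∀ φ → _⊨_ Atom model (K φ) → _⊨_ Atom model φ
    K-elimˡ φ h = ∧-elimˡ (trans (sym (eval-K φ)) h)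

    K-elimʳ : ∀ φ → _⊨_ Atom model (K φ) → _⊨_ Atom N φ
    K-elimʳ φ h = ∧-elimʳ {eval Atom model φ} (trans (sym (eval-K φ)) h)

    model-⊨-V : ∀ φ → Valid Atom φ → _⊨_ Atom model (K φ)
    model-⊨-V φ valid = K-intro φ (valid model) (valid N)

    model-⊨-K : ∀ φ ψ → _⊨_ Atom model (K (φ ⇒' ψ) ⇒' (K φ ⇒' K ψ))
    model-⊨-K φ ψ =
      ⊨-⇒-intro {model} (K (φ ⇒' ψ)) (K φ ⇒' K ψ) λ Kφψ →
      ⊨-⇒-intro {model} (K φ) (K ψ) λ Kφ →
      K-intro ψ (⊨-⇒-elim {model} φ ψ (K-elimˡ (φ ⇒' ψ) Kφψ) (K-elimˡ φ Kφ))
                (⊨-⇒-elim {N} φ ψ (K-elimʳ (φ ⇒' ψ) Kφψ) (K-elimʳ φ Kφ))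

    model-⊨-T : ∀ φ → _⊨_ Atom model (K φ ⇒' φ)
    model-⊨-T φ = ⊨-⇒-intro {model} (K φ) φ (K-elimˡ φ)

theorem11 : (Atom : Set) (p : Atom) → Consistent Atom (TKP Atom p)
theorem11 Atom p = model , model-⊨-TKP
  where
    open TwoWorldFrame allTrue (λ _ → false)

    model-⊨-TKP0 : ∀ {φ} → TKP0 Atom p φ → _⊨_ Atom model φ
    model-⊨-TKP0 (fromV φ valid) = model-⊨-V φ valid
    model-⊨-TKP0 (fromK φ ψ)     = model-⊨-K φ ψ
    model-⊨-TKP0 fromAx          = refl
    model-⊨-TKP0 (closure φ h)   = K-intro φ (model-⊨-TKP0 h) (allTrue-⊨-TKP0 h)

    model-⊨-TKP : _⊨T_ Atom model (TKP Atom p)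
    model-⊨-TKP _ (inj₁ h)          = model-⊨-TKP0 h
    model-⊨-TKP _ (inj₂ (φ , refl)) = model-⊨-T φ
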